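{- Let $\Gamma=(V,R)$ be a graph. Then the Frattini subgroup of $G_\Gamma$ is trivial: $\Phi(G_\Gamma)=1$.
   Context: Fix distinct odd primes $p,q$; $C_n$ cyclic of order $n$, $C_2=\{\pm1\}$; $D_p=\langle\beta,\gamma:\beta^2=\gamma^p=1,\beta\gamma\beta^{ -1}=\gamma^{ -1}\rangle$, $\tau:D_p\to C_2$ the epimorphism with kernel $\langle\gamma\rangle$; $D_p\times D_p$ acts on $C_q$ by $(x,y)\cdot g=g^{\tau(x)\tau(y)}$, $W=C_q\rtimes(D_p\times D_p)$, $\lambda:W\to D_p\times D_p$ the quotient. For a graph $\Gamma=(V,R)$ (edges written $r=(v,v')$), $G_\Gamma$ is the closed subgroup of $D_p^V\times W^R$ of tuples $((a_v),(b_r))$ with $\lambda(b_r)=(a_v,a_{v'})$ for every $r=(v,v')\in R$. The Frattini subgroup $\Phi(G)$ of a profinite group $G$ is the intersection of all maximal open subgroups. -}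

module Defs where

open import Level using (Level; suc; zero)
open import Data.Nat as ℕ using (ℕ; _+_; _∸_; NonZero)
open import Data.Nat.DivMod using (_mod_)
open import Data.Nat.Primality using (Prime; prime⇒nonZero)
open import Data.Fin using (Fin; toℕ)
open import Data.Bool using (Bool; true; false; if_then_else_; _xor_)
open import Data.Product using (Σ; ∃; _×_; _,_; proj₁; proj₂)
open import Data.List using (List)
open import Data.List.Relation.Unary.All using (All)
open import Relation.Nullary using (¬_)
open import Relation.Binary.PropositionalEquality using (_≡_; refl; cong₂; trans)

module Cyclic (n : ℕ) .⦃ _ : NonZero n ⦄ where
  C : Set
  C = Fin n

  0C : C
  0C = 0 mod n

  _+C_ : C → C → C
  a +C b = (toℕ a + toℕ b) mod n

  -C_ : C → C
  -C a = (n ∸ toℕ a) mod n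

module Construction (p q : ℕ) (pp : Prime p) (qp : Prime q) where

  private
    instance
      nzp : NonZero p
      nzp = prime⇒nonZero pp
      nzq : NonZero q
      nzq = prime⇒nonZero qp

  module Cp = Cyclic p
  module Cq = Cyclic q

  -- Dihedral group D_p.  The element (k , s) stands for γ^k β^s
  -- (s = true means β^1).  Using β γ β⁻¹ = γ⁻¹:
  --   (γ^a β^s)(γ^b β^t) = γ^(a ± b) β^(s xor t), with − iff s = true.
  D : Set
  D = Fin p × Bool

  1D : D
  1D = Cp.0C , false

  _·D_ : D → D → D
  (a , s) ·D (b , t) = (a Cp.+C (if s then Cp.-C b else b)) , (s xor t)

  invD : D → D
  invD (a , s) = (if s then a else Cp.-C a) , s

  -- τ : D_p → C_2 = {±1}, with kernel ⟨γ⟩; C_2 is encoded by Bool,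
  -- true ↔ −1, so multiplication in C_2 is xor.
  τ : D → Bool
  τ (_ , s) = s

  -- W = C_q ⋊ (D_p × D_p), with (x , y) · g = g^(τ x τ y).
  act : D → D → Fin q → Fin q
  act x y g = if τ x xor τ y then Cq.-C g else g

  W : Set
  W = Fin q × D × D

  1W : W
  1W = Cq.0C , 1D , 1D

  _·W_ : W → W → W
  (c , x , y) ·W (c' , x' , y') = (c Cq.+C act x y c') , (x ·D x') , (y ·D y')

  invW : W → W
  invW (c , x , y) = act (invD x) (invD y) (Cq.-C c) , invD x , invD y

  λW : W → D × D
  λW (_ , x , y) = x , y

  module Graph (V : Set) (R : V → V → Set) where

    Edge : Set
    Edge = Σ (V × V) (λ e → R (proj₁ e) (proj₂ e))

    src tgt : Edge → V
    src ((v , _) , _) = v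
    tgt ((_ , v') , _) = v'

    G : Set
    G = Σ ((V → D) × (Edge → W))
          (λ ab → (r : Edge) → λW (proj₂ ab r) ≡ (proj₁ ab (src r) , proj₁ ab (tgt r)))

    vert : G → V → D
    vert ((a , _) , _) = a

    edge : G → Edge → W
    edge ((_ , b) , _) = b

    -- equality in G_Γ (coordinatewise; no function extensionality needed)
    _≈_ : G → G → Set
    g ≈ h = ((v : V) → vert g v ≡ vert h v) × ((r : Edge) → edge g r ≡ edge h r)

    1G : G
    1G = ((λ _ → 1D) , (λ _ → 1W)) , (λ _ → refl)

    _·_ : G → G → G
    (((a , b) , e) · ((a' , b') , e')) =
      ((λ v → a v ·D a' v) , (λ r → b r ·W b' r)) ,
      (λ r → help (b r) (b' r) (e r) (e' r))
      where
      help : ∀ {x y x' y'} (w w' : W) → λW w ≡ (x , y) → λW w' ≡ (x' , y') →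
             λW (w ·W w') ≡ ((x ·D x') , (y ·D y'))
      help (c , x , y) (c' , x' , y') refl refl = refl

    inv : G → G
    inv ((a , b) , e) = ((λ v → invD (a v)) , (λ r → invW (b r))) ,
                        (λ r → help (b r) (e r))
      where
      help : ∀ {x y} (w : W) → λW w ≡ (x , y) → λW (invW w) ≡ (invD x , invD y)
      help (c , x , y) refl = refl

    record IsSubgroup (H : G → Set) : Set where
      field
        resp : ∀ {g h} → g ≈ h → H g → H h
        one  : H 1G
        mul  : ∀ {g h} → H g → H h → H (g · h)
        inv' : ∀ {g} → H g → H (inv g)

    -- Topology: G_Γ carries the subspace topology of the product topology
    -- on D_p^V × W^R (finite discrete factors).  A subgroup is open iff it
    -- contains a basic open neighbourhood of 1, i.e. the set of elements
    -- trivial at finitely many coordinates.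
    IsOpen : (G → Set) → Set
    IsOpen H = ∃ λ (F : List V) → ∃ λ (E : List Edge) →
      ∀ g → All (λ v → vert g v ≡ 1D) F → All (λ r → edge g r ≡ 1W) E → H g

    record IsMaximalOpen (H : G → Set) : Set₁ where
      field
        subgroup : IsSubgroup H
        open'    : IsOpen H
        proper   : ∃ λ g → ¬ H g
        maximal  : (K : G → Set) → IsSubgroup K → (∀ g → H g → K g) →
                   (∃ λ g → K g × ¬ H g) → ∀ g → K g

-- Φ(G_Γ) = 1 because the maximal open subgroups of G_Γ separate points. Each is cut out
-- by one coordinate: for a vertex v, τ(a_v) = 1 (index 2) and a_v ∈ ⟨β⟩ (index p); for an
-- edge r, b_r ∈ 1 ⋊ (D_p × D_p) (index q). For the last two, any k outside the subgroup
-- can be multiplied by its reflection part, which lies inside, to an element of the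
-- rotation subgroup; there the coordinate is additive in ℤ/p resp. ℤ/q, so by primality
-- the powers of that element meet every left coset, forcing maximality. An element lying
-- in all of these subgroups has trivial vertex coordinates, and then trivial edge
-- coordinates because λ(b_r) = (a_v , a_v').
module Submission where

open import Defs
open import Level using (0ℓ)
open import Algebra.Bundles using (AbelianGroup)
open import Algebra.Structures using (IsAbelianGroup)
open import Data.Nat using (ℕ; zero; suc; _+_; _*_; _∸_; _<_; NonZero; nonTrivial⇒n>1)
open import Data.Nat.Properties using (1+n≢0; m+[n∸m]≡n; <⇒≤; *-assoc; +-assoc; +-comm; *-identityʳ; n≢0⇒n>0)
open import Data.Nat.DivMod using (_%_; _mod_; [m+n]%n≡m%n; [m+kn]%n≡m%n; n%n≡0; m*n%n≡0; m<n⇒m%n≡m; m%n<n; %-distribˡ-+; %-distribˡ-*)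
open import Data.Nat.Primality using (Prime; prime⇒nonZero; prime⇒nonTrivial)
open import Data.Nat.Coprimality using (prime⇒coprime; coprime-Bézout)
open import Data.Nat.GCD using (module Bézout)
open import Data.Nat.Tactic.RingSolver using (solve-∀)
open import Data.Fin using (Fin; toℕ)
open import Data.Fin.Properties using (toℕ-injective; toℕ-fromℕ<; toℕ<n)
open import Data.Bool using (true; false; if_then_else_; _xor_)
open import Data.Bool.Properties using (xor-same; ¬-not) renaming (_≟_ to _≟B_)
open import Data.List using ([]; _∷_)
open import Data.List.Relation.Unary.All using ([]; _∷_)
open import Data.Product using (∃; _,_; proj₁; proj₂)
open import Relation.Nullary using (¬_; yes; no)
open import Relation.Unary using (Decidable)
open import Relation.Binary.PropositionalEquality
open ≡-Reasoning

-- In the +- case of Bézout, 1 + y A = x n, so the inverse of A is −y ≡ (n − 1) y.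
modular-inverse : ∀ n .⦃ _ : NonZero n ⦄ → Prime n → ∀ {A} → 0 < A → A < n →
                  ∃ λ w → (w * A) % n ≡ 1 % n
modular-inverse (suc k) n-prime {A@(suc _)} _ A<n with coprime-Bézout (prime⇒coprime n-prime A<n)
... | Bézout.-+ x y eq = y , trans (cong (_% suc k) (sym eq)) ([m+kn]%n≡m%n 1 x (suc k))
... | Bézout.+- x y eq = k * y , (begin
  k * y * A % n               ≡⟨ [m+n]%n≡m%n (k * y * A) n ⟨
  (k * y * A + n) % n         ≡⟨ cong (_% n) (expand k y A) ⟩
  (1 + k * (1 + y * A)) % n   ≡⟨ cong (λ m → (1 + k * m) % n) eq ⟩
  (1 + k * (x * n)) % n       ≡⟨ cong (λ m → (1 + m) % n) (*-assoc k x n) ⟨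
  (1 + k * x * n) % n         ≡⟨ [m+kn]%n≡m%n 1 (k * x) n ⟩
  1 % n                       ∎)
  where
  n = suc k
  expand : ∀ k y a → k * y * a + suc k ≡ 1 + k * (1 + y * a)
  expand = solve-∀

module ResidueGroup (n : ℕ) .⦃ _ : NonZero n ⦄ where
  open Cyclic n

  mod-cong : ∀ {x y} → x % n ≡ y % n → x mod n ≡ y mod n
  mod-cong eq = toℕ-injective (trans (toℕ-fromℕ< _) (trans eq (sym (toℕ-fromℕ< _))))

  toℕ-mod : (a : C) → toℕ a mod n ≡ a
  toℕ-mod a = toℕ-injective (trans (toℕ-fromℕ< _) (m<n⇒m%n≡m (toℕ<n a)))

  toℕ-0C : toℕ 0C ≡ 0
  toℕ-0C = trans (toℕ-fromℕ< _) (m*n%n≡0 0 n)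

  mod-+ : ∀ x y → (x mod n) +C (y mod n) ≡ (x + y) mod n
  mod-+ x y = mod-cong (begin
    (toℕ (x mod n) + toℕ (y mod n)) % n ≡⟨ cong₂ (λ u v → (u + v) % n) (toℕ-fromℕ< (m%n<n x n)) (toℕ-fromℕ< (m%n<n y n)) ⟩
    (x % n + y % n) % n                 ≡⟨ %-distribˡ-+ x y n ⟨
    (x + y) % n                         ∎)

  +C-assoc : ∀ a b c → (a +C b) +C c ≡ a +C (b +C c)
  +C-assoc a b c = begin
    (a +C b) +C c                                   ≡⟨ cong ((a +C b) +C_) (toℕ-mod c) ⟨
    ((toℕ a + toℕ b) mod n) +C (toℕ c mod n)        ≡⟨ mod-+ (toℕ a + toℕ b) (toℕ c) ⟩
    (toℕ a + toℕ b + toℕ c) mod n                   ≡⟨ cong (_mod n) (+-assoc (toℕ a) (toℕ b) (toℕ c)) ⟩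
    (toℕ a + (toℕ b + toℕ c)) mod n                 ≡⟨ mod-+ (toℕ a) (toℕ b + toℕ c) ⟨
    (toℕ a mod n) +C ((toℕ b + toℕ c) mod n)        ≡⟨ cong (_+C (b +C c)) (toℕ-mod a) ⟩
    a +C (b +C c)                                   ∎

  +C-comm : ∀ a b → a +C b ≡ b +C a
  +C-comm a b = cong (_mod n) (+-comm (toℕ a) (toℕ b))

  +C-identityˡ : ∀ a → 0C +C a ≡ a
  +C-identityˡ a = begin
    0C +C a                 ≡⟨ cong (0C +C_) (toℕ-mod a) ⟨
    0C +C (toℕ a mod n)     ≡⟨ mod-+ 0 (toℕ a) ⟩
    toℕ a mod n             ≡⟨ toℕ-mod a ⟩
    a                       ∎

  -C-inverseʳ : ∀ a → a +C (-C a) ≡ 0C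
  -C-inverseʳ a = begin
    a +C (-C a)                     ≡⟨ cong (_+C (-C a)) (toℕ-mod a) ⟨
    (toℕ a mod n) +C (-C a)         ≡⟨ mod-+ (toℕ a) (n ∸ toℕ a) ⟩
    (toℕ a + (n ∸ toℕ a)) mod n     ≡⟨ mod-cong (trans (cong (_% n) (m+[n∸m]≡n (<⇒≤ (toℕ<n a)))) (trans (n%n≡0 n) (sym (m*n%n≡0 0 n)))) ⟩
    0C                              ∎

  +C-isAbelianGroup : IsAbelianGroup _≡_ _+C_ 0C -C_
  +C-isAbelianGroup = record
    { isGroup = record
      { isMonoid = record
        { isSemigroup = record
          { isMagma = record { isEquivalence = isEquivalence ; ∙-cong = cong₂ _+C_ }
          ; assoc = +C-assoc }
        ; identity = +C-identityˡ , λ a → trans (+C-comm a 0C) (+C-identityˡ a) }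
      ; inverse = (λ a → trans (+C-comm (-C a) a) (-C-inverseʳ a)) , -C-inverseʳ
      ; ⁻¹-cong = cong -C_ }
    ; comm = +C-comm }

  +C-abelianGroup : AbelianGroup 0ℓ 0ℓ
  +C-abelianGroup = record { isAbelianGroup = +C-isAbelianGroup }

  open import Algebra.Properties.AbelianGroup +C-abelianGroup public
  open import Algebra.Definitions.RawMonoid (AbelianGroup.rawMonoid +C-abelianGroup) public
    using (_×_)
  open AbelianGroup +C-abelianGroup public using (identityˡ; identityʳ; inverseˡ; inverseʳ)

  ×-mod : ∀ j a → j × a ≡ (j * toℕ a) mod n
  ×-mod zero    a = refl
  ×-mod (suc j) a = begin
    a +C (j × a)                          ≡⟨ cong₂ _+C_ (toℕ-mod a) (sym (×-mod j a)) ⟨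
    (toℕ a mod n) +C ((j * toℕ a) mod n)  ≡⟨ mod-+ (toℕ a) (j * toℕ a) ⟩
    (suc j * toℕ a) mod n                 ∎

  toℕ-positive : ∀ {a} → a ≢ 0C → 0 < toℕ a
  toℕ-positive a≢0 = n≢0⇒n>0 (λ a≡0 → a≢0 (toℕ-injective (trans a≡0 (sym toℕ-0C))))

  ×-surjective : Prime n → ∀ {a} → a ≢ 0C → ∀ b → ∃ λ j → j × a ≡ b
  ×-surjective n-prime {a} a≢0 b
    with w , w*A≡1 ← modular-inverse n n-prime (toℕ-positive a≢0) (toℕ<n a) =
    B * w , (begin
      (B * w) × a               ≡⟨ ×-mod (B * w) a ⟩
      (B * w * toℕ a) mod n     ≡⟨ mod-cong B*w*A≡B ⟩
      B mod n                   ≡⟨ toℕ-mod b ⟩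
      b                         ∎)
    where
    B = toℕ b
    B*w*A≡B : (B * w * toℕ a) % n ≡ B % n
    B*w*A≡B = begin
      (B * w * toℕ a) % n             ≡⟨ cong (_% n) (*-assoc B w (toℕ a)) ⟩
      (B * (w * toℕ a)) % n           ≡⟨ %-distribˡ-* B (w * toℕ a) n ⟩
      (B % n * ((w * toℕ a) % n)) % n ≡⟨ cong (λ m → (B % n * m) % n) w*A≡1 ⟩
      (B % n * (1 % n)) % n           ≡⟨ %-distribˡ-* B 1 n ⟨
      (B * 1) % n                     ≡⟨ cong (_% n) (*-identityʳ B) ⟩
      B % n                           ∎

  1≢0C : 1 < n → 1 mod n ≢ 0C
  1≢0C 1<n 1≡0 = 1+n≢0 (begin
    1                 ≡⟨ m<n⇒m%n≡m 1<n ⟨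
    1 % n             ≡⟨ toℕ-fromℕ< _ ⟨
    toℕ (1 mod n)     ≡⟨ cong toℕ 1≡0 ⟩
    toℕ 0C            ≡⟨ toℕ-0C ⟩
    0                 ∎)

  ±-≡0C : ∀ s {a} → a ≡ 0C → (if s then -C a else a) ≡ 0C
  ±-≡0C false a≡0 = a≡0
  ±-≡0C true  a≡0 = trans (cong -C_ a≡0) ε⁻¹≈ε

  x+[y−x]≡y : ∀ a b → a +C (b +C (-C a)) ≡ b
  x+[y−x]≡y a b = trans (+C-comm a (b +C (-C a))) (//-rightDividesˡ a b)

  x−[x−y]≡y : ∀ a b → a +C (-C (a +C (-C b))) ≡ b
  x−[x−y]≡y a b = trans (cong (a +C_) (⁻¹-anti-homo-// a b)) (x+[y−x]≡y a b)

module Frattini (p q : ℕ) (pp : Prime p) (qp : Prime q) (V : Set) (R : V → V → Set) where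
  open Construction p q pp qp
  open Graph V R
  open import Data.Product using (_×_)

  private
    instance
      p-nonZero : NonZero p
      p-nonZero = prime⇒nonZero pp
      q-nonZero : NonZero q
      q-nonZero = prime⇒nonZero qp

  module ℤₚ = ResidueGroup p
  module ℤq = ResidueGroup q

  rotation : D → Fin p
  rotation = proj₁

  _\\D_ : D → D → D
  x \\D y = invD x ·D y

  \\D-leftDivides : ∀ x y → x ·D (x \\D y) ≡ y
  \\D-leftDivides (a , false) (b , t)     = cong (_, t) (ℤₚ.\\-leftDividesˡ a b)
  \\D-leftDivides (a , true)  (b , false) = cong (_, false) (ℤₚ.x−[x−y]≡y a b)
  \\D-leftDivides (a , true)  (b , true)  = cong (_, true) (ℤₚ.x−[x−y]≡y a b)

  act-involutive : ∀ x y c → act x y (act x y c) ≡ c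
  act-involutive x y c with τ x xor τ y
  ... | false = refl
  ... | true  = ℤq.⁻¹-involutive c

  _\\W_ : W → W → W
  (c , x , y) \\W (c' , x' , y') = act x y (c' Cq.+C (Cq.-C c)) , x \\D x' , y \\D y'

  \\W-leftDivides : ∀ w w' → w ·W (w \\W w') ≡ w'
  \\W-leftDivides (c , x , y) (c' , x' , y') = cong₂ _,_
    (trans (cong (c Cq.+C_) (act-involutive x y _)) (ℤq.x+[y−x]≡y c c'))
    (cong₂ _,_ (\\D-leftDivides x x') (\\D-leftDivides y y'))

  _\\_ : G → G → G
  ((a , b) , e) \\ ((a' , b') , e') =
    ((λ v → a v \\D a' v) , (λ r → b r \\W b' r)) ,
    (λ r → cong₂ (λ u u' → proj₁ u \\D proj₁ u' , proj₂ u \\D proj₂ u') (e r) (e' r))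

  \\-leftDivides : ∀ g h → (g · (g \\ h)) ≈ h
  \\-leftDivides g h = (λ v → \\D-leftDivides (vert g v) (vert h v)) ,
                       (λ r → \\W-leftDivides (edge g r) (edge h r))

  ∈-of-\\ : ∀ {K} → IsSubgroup K → ∀ {m g} → K m → K (m \\ g) → K g
  ∈-of-\\ K-sub {m} {g} m∈K m\\g∈K =
    IsSubgroup.resp K-sub (\\-leftDivides m g) (IsSubgroup.mul K-sub m∈K m\\g∈K)

  _^_ : G → ℕ → G
  g ^ zero  = 1G
  g ^ suc j = g · (g ^ j)

  ^-closed : ∀ {K} → IsSubgroup K → ∀ {g} → K g → ∀ j → K (g ^ j)
  ^-closed K-sub g∈K zero    = IsSubgroup.one K-sub
  ^-closed K-sub g∈K (suc j) = IsSubgroup.mul K-sub g∈K (^-closed K-sub g∈K j)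

  reflection : D → D
  reflection x = Cp.0C , τ x

  ·D-reflection : ∀ x → x ·D reflection x ≡ (rotation x , false)
  ·D-reflection (a , s) =
    cong₂ _,_ (trans (cong (a Cp.+C_) (ℤₚ.±-≡0C s refl)) (ℤₚ.identityʳ a)) (xor-same s)

  reflections : G → G
  reflections g =
    ((λ v → reflection (vert g v)) ,
     (λ r → Cq.0C , reflection (proj₁ (λW (edge g r))) , reflection (proj₂ (λW (edge g r))))) ,
    (λ r → cong (λ u → reflection (proj₁ u) , reflection (proj₂ u)) (proj₂ g r))

  Rotational : G → Set
  Rotational g = (∀ v → τ (vert g v) ≡ false) ×
                 (∀ r → τ (proj₁ (λW (edge g r))) ≡ false × τ (proj₂ (λW (edge g r))) ≡ false)

  rotational-1G : Rotational 1G
  rotational-1G = (λ _ → refl) , (λ _ → refl , refl)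

  rotational-· : ∀ {g h} → Rotational g → Rotational h → Rotational (g · h)
  rotational-· (gᵥ , gᵣ) (hᵥ , hᵣ) =
    (λ v → cong₂ _xor_ (gᵥ v) (hᵥ v)) ,
    (λ r → cong₂ _xor_ (proj₁ (gᵣ r)) (proj₁ (hᵣ r)) , cong₂ _xor_ (proj₂ (gᵣ r)) (proj₂ (hᵣ r)))

  rotational-^ : ∀ {g} → Rotational g → ∀ j → Rotational (g ^ j)
  rotational-^ rot zero    = rotational-1G
  rotational-^ {g} rot (suc j) = rotational-· {g} {g ^ j} rot (rotational-^ rot j)

  rotational-·-reflections : ∀ k → Rotational (k · reflections k)
  rotational-·-reflections k =
    (λ v → xor-same (τ (vert k v))) ,
    (λ r → xor-same (τ (proj₁ (λW (edge k r)))) , xor-same (τ (proj₂ (λW (edge k r)))))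

  Maximal : (G → Set) → Set₁
  Maximal H = (K : G → Set) → IsSubgroup K → (∀ g → H g → K g) → (∃ λ g → K g × ¬ H g) → ∀ g → K g

  maximal-if-complement-is-coset : ∀ {H} → Decidable H →
                                   (∀ {m g} → ¬ H m → ¬ H g → H (m \\ g)) → Maximal H
  maximal-if-complement-is-coset H? coset K K-sub H⊆K (k , k∈K , k∉H) g with H? g
  ... | yes g∈H = H⊆K g g∈H
  ... | no  g∉H = ∈-of-\\ K-sub k∈K (H⊆K _ (coset k∉H g∉H))

  record IsCyclicCoordinate {n} .⦃ _ : NonZero n ⦄ (ℓ : G → Cyclic.C n) : Set where
    open Cyclic n
    field
      ker-isSubgroup  : IsSubgroup (λ g → ℓ g ≡ 0C)
      ℓ-\\            : ∀ m g → ℓ m ≡ ℓ g → ℓ (m \\ g) ≡ 0C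
      ℓ-reflections   : ∀ k → ℓ (reflections k) ≡ 0C
      ℓ-·-reflections : ∀ k → ℓ (k · reflections k) ≡ ℓ k
      ℓ-·-rotational  : ∀ {g h} → Rotational g → Rotational h → ℓ (g · h) ≡ ℓ g +C ℓ h

  module _ {n} .⦃ _ : NonZero n ⦄ (n-prime : Prime n) {ℓ : G → Cyclic.C n}
           (isCyclicCoordinate : IsCyclicCoordinate ℓ) where
    module ℤₙ = ResidueGroup n
    open Cyclic n
    open IsCyclicCoordinate isCyclicCoordinate

    ℓ-^ : ∀ {z} → Rotational z → ∀ j → ℓ (z ^ j) ≡ j ℤₙ.× ℓ z
    ℓ-^ rot zero = IsSubgroup.one ker-isSubgroup
    ℓ-^ {z} rot (suc j) =
      trans (ℓ-·-rotational {z} {z ^ j} rot (rotational-^ rot j)) (cong (ℓ z +C_) (ℓ-^ rot j))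

    maximal-if-cyclicCoordinate : Maximal (λ g → ℓ g ≡ 0C)
    maximal-if-cyclicCoordinate K K-sub H⊆K (k , k∈K , ℓk≢0) g
      with j , j×ℓk≡ℓg ← ℤₙ.×-surjective n-prime ℓk≢0 (ℓ g) =
      ∈-of-\\ K-sub (^-closed K-sub z∈K j) (H⊆K _ (ℓ-\\ (z ^ j) g ℓz^j≡ℓg))
      where
      z = k · reflections k
      z∈K : K z
      z∈K = IsSubgroup.mul K-sub k∈K (H⊆K _ (ℓ-reflections k))
      ℓz^j≡ℓg : ℓ (z ^ j) ≡ ℓ g
      ℓz^j≡ℓg = trans (ℓ-^ (rotational-·-reflections k) j)
                      (trans (cong (j ℤₙ.×_) (ℓ-·-reflections k)) j×ℓk≡ℓg)

    ker-isMaximalOpen : IsOpen (λ g → ℓ g ≡ 0C) → (∃ λ g → ℓ g ≢ 0C) →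
                        IsMaximalOpen (λ g → ℓ g ≡ 0C)
    ker-isMaximalOpen isOpen proper = record
      { subgroup = ker-isSubgroup
      ; open'    = isOpen
      ; proper   = proper
      ; maximal  = maximal-if-cyclicCoordinate }

  constant : D → Fin q → G
  constant d c = ((λ _ → d) , (λ _ → c , d , d)) , (λ _ → refl)

  τ-ker-isMaximalOpen : ∀ v → IsMaximalOpen (λ g → τ (vert g v) ≡ false)
  τ-ker-isMaximalOpen v = record
    { subgroup = record
      { resp = λ (g≈h , _) τg≡f → trans (cong τ (sym (g≈h v))) τg≡f
      ; one  = refl
      ; mul  = cong₂ _xor_
      ; inv' = λ τg≡f → τg≡f }
    ; open'    = (v ∷ []) , [] , λ { g (gᵥ≡1 ∷ []) _ → cong τ gᵥ≡1 }
    ; proper   = constant (Cp.0C , true) Cq.0C , λ ()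
    ; maximal  = maximal-if-complement-is-coset (λ g → τ (vert g v) ≟B false)
                   (λ τm≢f τg≢f → cong₂ _xor_ (¬-not τm≢f) (¬-not τg≢f)) }

  rotation-·D-≡0C : ∀ x y → rotation x ≡ Cp.0C → rotation y ≡ Cp.0C → rotation (x ·D y) ≡ Cp.0C
  rotation-·D-≡0C (a , s) (b , t) a≡0 b≡0 =
    trans (cong₂ Cp._+C_ a≡0 (ℤₚ.±-≡0C s b≡0)) (ℤₚ.identityʳ Cp.0C)

  rotation-invD-≡0C : ∀ x → rotation x ≡ Cp.0C → rotation (invD x) ≡ Cp.0C
  rotation-invD-≡0C (a , false) a≡0 = ℤₚ.±-≡0C true a≡0
  rotation-invD-≡0C (a , true)  a≡0 = a≡0

  rotation-\\D : ∀ x y → rotation x ≡ rotation y → rotation (x \\D y) ≡ Cp.0C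
  rotation-\\D (a , false) (b , t) a≡b = trans (cong ((Cp.-C a) Cp.+C_) (sym a≡b)) (ℤₚ.inverseˡ a)
  rotation-\\D (a , true)  (b , t) a≡b = trans (cong (Cp._+C (Cp.-C b)) a≡b) (ℤₚ.inverseʳ b)

  rotation-·D : ∀ x y → τ x ≡ false → rotation (x ·D y) ≡ rotation x Cp.+C rotation y
  rotation-·D (a , s) (b , t) s≡f = cong (λ s → a Cp.+C (if s then Cp.-C b else b)) s≡f

  rotation-isCyclicCoordinate : ∀ v → IsCyclicCoordinate (λ g → rotation (vert g v))
  rotation-isCyclicCoordinate v = record
    { ker-isSubgroup = record
      { resp = λ (g≈h , _) rg≡0 → trans (cong rotation (sym (g≈h v))) rg≡0
      ; one  = refl
      ; mul  = λ {g} {h} → rotation-·D-≡0C (vert g v) (vert h v)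
      ; inv' = λ {g} → rotation-invD-≡0C (vert g v) }
    ; ℓ-\\            = λ m g → rotation-\\D (vert m v) (vert g v)
    ; ℓ-reflections   = λ _ → refl
    ; ℓ-·-reflections = λ k → cong rotation (·D-reflection (vert k v))
    ; ℓ-·-rotational  = λ {g} {h} (gᵥ , _) _ → rotation-·D (vert g v) (vert h v) (gᵥ v) }

  rotation-ker-isMaximalOpen : ∀ v → IsMaximalOpen (λ g → rotation (vert g v) ≡ Cp.0C)
  rotation-ker-isMaximalOpen v = ker-isMaximalOpen pp (rotation-isCyclicCoordinate v)
    ((v ∷ []) , [] , λ { g (gᵥ≡1 ∷ []) _ → cong rotation gᵥ≡1 })
    (constant (1 mod p , false) Cq.0C , ℤₚ.1≢0C (nonTrivial⇒n>1 p ⦃ prime⇒nonTrivial pp ⦄))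

  cq : W → Fin q
  cq = proj₁

  cq-·W-≡0C : ∀ w w' → cq w ≡ Cq.0C → cq w' ≡ Cq.0C → cq (w ·W w') ≡ Cq.0C
  cq-·W-≡0C (c , x , y) (c' , _) c≡0 c'≡0 =
    trans (cong₂ Cq._+C_ c≡0 (ℤq.±-≡0C (τ x xor τ y) c'≡0)) (ℤq.identityʳ Cq.0C)

  cq-invW-≡0C : ∀ w → cq w ≡ Cq.0C → cq (invW w) ≡ Cq.0C
  cq-invW-≡0C (c , x , y) c≡0 = ℤq.±-≡0C (τ (invD x) xor τ (invD y)) (ℤq.±-≡0C true c≡0)

  cq-\\W : ∀ w w' → cq w ≡ cq w' → cq (w \\W w') ≡ Cq.0C
  cq-\\W (c , x , y) (c' , _) c≡c' =
    ℤq.±-≡0C (τ x xor τ y) (trans (cong (λ d → c' Cq.+C (Cq.-C d)) c≡c') (ℤq.inverseʳ c'))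

  cq-·W-reflection : ∀ c x y → cq ((c , x , y) ·W (Cq.0C , reflection x , reflection y)) ≡ c
  cq-·W-reflection c x y = trans (cong (c Cq.+C_) (ℤq.±-≡0C (τ x xor τ y) refl)) (ℤq.identityʳ c)

  cq-·W : ∀ c x y w' → τ x ≡ false → τ y ≡ false → cq ((c , x , y) ·W w') ≡ c Cq.+C cq w'
  cq-·W c x y (c' , _) τx≡f τy≡f =
    cong (λ s → c Cq.+C (if s then Cq.-C c' else c')) (cong₂ _xor_ τx≡f τy≡f)

  cq-isCyclicCoordinate : ∀ r → IsCyclicCoordinate (λ g → cq (edge g r))
  cq-isCyclicCoordinate r = record
    { ker-isSubgroup = record
      { resp = λ (_ , g≈h) cg≡0 → trans (cong cq (sym (g≈h r))) cg≡0
      ; one  = refl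
      ; mul  = λ {g} {h} → cq-·W-≡0C (edge g r) (edge h r)
      ; inv' = λ {g} → cq-invW-≡0C (edge g r) }
    ; ℓ-\\            = λ m g → cq-\\W (edge m r) (edge g r)
    ; ℓ-reflections   = λ _ → refl
    ; ℓ-·-reflections = λ k → cq-·W-reflection (cq (edge k r)) (proj₁ (λW (edge k r))) (proj₂ (λW (edge k r)))
    ; ℓ-·-rotational  = λ {g} {h} (_ , gᵣ) _ →
        cq-·W (cq (edge g r)) (proj₁ (λW (edge g r))) (proj₂ (λW (edge g r))) (edge h r)
              (proj₁ (gᵣ r)) (proj₂ (gᵣ r)) }

  cq-ker-isMaximalOpen : ∀ r → IsMaximalOpen (λ g → cq (edge g r) ≡ Cq.0C)
  cq-ker-isMaximalOpen r = ker-isMaximalOpen qp (cq-isCyclicCoordinate r)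
    ([] , (r ∷ []) , λ { g _ (gᵣ≡1 ∷ []) → cong cq gᵣ≡1 })
    (constant 1D (1 mod q) , ℤq.1≢0C (nonTrivial⇒n>1 q ⦃ prime⇒nonTrivial qp ⦄))

lemma2p7 : (p q : ℕ) (pp : Prime p) (qp : Prime q) → p % 2 ≡ 1 → q % 2 ≡ 1 → p ≢ q →
           (V : Set) (R : V → V → Set) →
           let open Construction.Graph p q pp qp V R in
           (g : G) → ((H : G → Set) → IsMaximalOpen H → H g) → g ≈ 1G
lemma2p7 p q pp qp _ _ _ V R g g∈Φ = vert≡1D , edge≡1W
  where
  open Construction p q pp qp
  open Graph V R
  open Frattini p q pp qp V R

  vert≡1D : ∀ v → vert g v ≡ 1D
  vert≡1D v = cong₂ _,_ (g∈Φ _ (rotation-ker-isMaximalOpen v)) (g∈Φ _ (τ-ker-isMaximalOpen v))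

  edge≡1W : ∀ r → edge g r ≡ 1W
  edge≡1W r = cong₂ _,_ (g∈Φ _ (cq-ker-isMaximalOpen r))
                        (trans (proj₂ g r) (cong₂ _,_ (vert≡1D (src r)) (vert≡1D (tgt r))))
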